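{- Let $t\geq 4$ and let $G$ be a connected $K^2_t$-saturated graph of order $n$. Then there exists $v\in V(G)$ such that $d_{H}(v)\neq t-1$ for every subgraph $H$ of $G$ isomorphic to $K^1_t$ (i.e., $v$ is not a vertex of degree $t-1$ in any copy of $K^1_t$ in $G$).
   Context: All graphs are finite and simple. For $s\ge0$ and $t\ge\max\{3,s\}$, the virus $K^s_t$ is the graph on $s+t$ vertices obtained from $K_t$ by attaching $s$ pendant vertices to $s$ distinct vertices of $K_t$; thus $K^1_t$ is $K_t$ with one pendant vertex. A graph $G$ is $K^2_t$-saturated if it contains no subgraph isomorphic to $K^2_t$ but $G+uv$ contains one for every pair of non-adjacent vertices $u,v$; a graph with fewer than $t+2$ vertices is not $K^2_t$-saturated by convention. -}

module Defs where

open import Data.Nat using (ℕ; _+_; _≡ᵇ_)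
open import Data.Bool using (Bool; true; false; not; _∧_; _∨_; T)
open import Data.Fin using (Fin; toℕ; splitAt; _≟_)
open import Data.Fin.Properties using ()
open import Data.Sum using (_⊎_; inj₁; inj₂)
open import Data.List using (length; filterᵇ; allFin)
open import Data.Product using (Σ; _×_; _,_)
open import Relation.Binary.PropositionalEquality using (_≡_; _≢_)
open import Relation.Nullary using (¬_; does)
open import Function.Definitions using (Injective)

Graph : ℕ → Set
Graph n = Fin n → Fin n → Bool

Edge : ∀ {n} → Graph n → Fin n → Fin n → Set
Edge G u v = T (G u v)

IsSimple : ∀ {n} → Graph n → Set
IsSimple G = (∀ u v → G u v ≡ G v u) × (∀ u → G u u ≡ false)

degree : ∀ {n} → Graph n → Fin n → ℕ
degree {n} G v = length (filterᵇ (G v) (allFin n))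

-- The virus K^s_t on vertex set Fin (t + s): the first t vertices form K_t,
-- and the pendant vertex t+k (k < s) is attached to clique vertex k.
Virus : (s t : ℕ) → Graph (t + s)
Virus s t x y with splitAt t {s} x | splitAt t {s} y
... | inj₁ i | inj₁ j = not (toℕ i ≡ᵇ toℕ j)
... | inj₁ i | inj₂ k = toℕ i ≡ᵇ toℕ k
... | inj₂ k | inj₁ i = toℕ i ≡ᵇ toℕ k
... | inj₂ _ | inj₂ _ = false

record Embedding {m n} (H : Graph m) (G : Graph n) : Set where
  field
    map       : Fin m → Fin n
    injective : Injective _≡_ _≡_ map
    preserves : ∀ x y → Edge H x y → Edge G (map x) (map y)

Contains : ∀ {m n} → Graph m → Graph n → Set
Contains H G = Embedding H G

addEdge : ∀ {n} → Graph n → Fin n → Fin n → Graph n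
addEdge G u v x y =
  G x y ∨ ((does (x ≟ u) ∧ does (y ≟ v)) ∨ (does (x ≟ v) ∧ does (y ≟ u)))

-- K^2_t-saturated (graphs with fewer than t+2 vertices are not saturated)
Saturated : ∀ {n} → ℕ → Graph n → Set
Saturated {n} t G =
  (t + 2 Data.Nat.≤ n)
  × (¬ Contains (Virus 2 t) G)
  × (∀ u v → u ≢ v → G u v ≡ false → Contains (Virus 2 t) (addEdge G u v))

data Reach {n} (G : Graph n) : Fin n → Fin n → Set where
  here : ∀ {u} → Reach G u u
  step : ∀ {u w v} → Edge G u w → Reach G w v → Reach G u v

Connected : ∀ {n} → Graph n → Set
Connected G = ∀ u v → Reach G u v

{-# OPTIONS --safe #-}
module Submission where

-- If G has no t-clique, every vertex will do. Otherwise fix a t-clique Q. As G is connected and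
-- has more than t vertices, some vertex a of Q has a neighbour x outside Q, and since G contains
-- no K²ₜ, two distinct vertices of Q never have distinct neighbours outside Q. So either
--  (A) a is the only vertex of Q with a neighbour outside Q, or
--  (B) x is the only vertex outside Q with a neighbour in Q, and it has at least two of them.
-- Consider a copy of K¹ₜ in which v has degree t − 1: a t-clique K containing v and a pendant
-- attached to another vertex of K. In case A take v = a. If K meets Q − a then K and its pendant
-- all lie in Q, too many vertices; otherwise one of two vertices of Q − a is a second pendant at a,
-- giving a K²ₜ. In case B take v = x; by connectivity x has a neighbour r outside Q ∪ {x}. If K
-- meets Q then K lies in Q ∪ {x} and r is a second pendant at x; otherwise one of the two
-- neighbours of x in Q is.

open import Defs
open import Data.Bool using (true; false; not; T)
open import Data.Empty using (⊥; ⊥-elim)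
open import Data.Fin using (Fin; zero; suc; toℕ; splitAt; _↑ˡ_; _↑ʳ_; _≟_; punchIn; fromℕ<)
open import Data.Fin.Properties
  using ( any?; all?; injective⇒≤; punchIn-injective; punchInᵢ≢i; toℕ-injective; ↑ˡ-injective
        ; splitAt-↑ˡ; splitAt-↑ʳ; splitAt⁻¹-↑ˡ; splitAt⁻¹-↑ʳ )
open import Data.Fin.Permutation using (Permutation′; transpose; _∘ₚ_; _⟨$⟩ʳ_)
import Data.Fin.Permutation.Components as PC
open import Data.List using (_∷_; length; filterᵇ; tabulate)
open import Data.List.Properties
  using (filter-all; filter-none; filter-accept; filter-reject; length-tabulate)
open import Data.List.Relation.Unary.All using (All)
open import Data.List.Relation.Unary.All.Properties using (tabulate⁺)
open import Data.Nat using (ℕ; zero; suc; _+_; _∸_; _≤_; _<_; _≡ᵇ_; s≤s; z≤n)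
open import Data.Nat.Properties
  using (≡ᵇ⇒≡; ≡⇒≡ᵇ; m+1+n≢m; <⇒≢; <⇒≱; <⇒≤; ≤-trans; +-comm; 1+n≰n)
open import Data.Product using (Σ; ∃; ∃-syntax; _×_; _,_; proj₁; proj₂)
open import Data.Sum using (inj₁; inj₂; [_,_]′)
open import Data.Vec.Functional using (head; tail) renaming (_∷_ to _∷ᶠ_)
open import Function using (_∘_; id)
open import Function.Bundles using (Injection)
open import Function.Definitions using (Injective)
open import Function.Properties.Inverse using (↔⇒↣)
open import Relation.Binary.PropositionalEquality
  using (_≡_; _≢_; _≗_; refl; sym; trans; cong; subst; subst₂; module ≡-Reasoning)
open import Relation.Nullary using (¬_; Dec; yes; no; ¬?; T?)
open import Relation.Nullary.Decidable
  using (dec-true; dec-false; map′; _→-dec_; _×-dec_; decidable-stable)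

T-not⁺ : ∀ {b} → ¬ T b → T (not b)
T-not⁺ {false} _  = _
T-not⁺ {true}  ¬b = ¬b _

T-not⁻ : ∀ {b} → T (not b) → ¬ T b
T-not⁻ {false} _ ()

data VirusVertex (t s : ℕ) : Fin (t + s) → Set where
  clique-vertex  : (i : Fin t) → VirusVertex t s (i ↑ˡ s)
  pendant-vertex : (k : Fin s) → VirusVertex t s (t ↑ʳ k)

virusVertex : ∀ t s x → VirusVertex t s x
virusVertex t s x with splitAt t {s} x in eq
... | inj₁ i = subst (VirusVertex t s) (splitAt⁻¹-↑ˡ eq) (clique-vertex i)
... | inj₂ k = subst (VirusVertex t s) (splitAt⁻¹-↑ʳ eq) (pendant-vertex k)

↑ˡ≢↑ʳ : ∀ {t s} (i : Fin t) (k : Fin s) → i ↑ˡ s ≢ t ↑ʳ k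
↑ˡ≢↑ʳ {t} {s} i k e
  with () ← trans (sym (splitAt-↑ˡ t i s)) (trans (cong (splitAt t) e) (splitAt-↑ʳ t s k))

module _ (s t : ℕ) where

  Virus-clique-clique : ∀ (i j : Fin t) → Virus s t (i ↑ˡ s) (j ↑ˡ s) ≡ not (toℕ i ≡ᵇ toℕ j)
  Virus-clique-clique i j rewrite splitAt-↑ˡ t i s | splitAt-↑ˡ t j s = refl

  Virus-clique-pendant : ∀ (i : Fin t) (k : Fin s) →
    Virus s t (i ↑ˡ s) (t ↑ʳ k) ≡ (toℕ i ≡ᵇ toℕ k)
  Virus-clique-pendant i k rewrite splitAt-↑ˡ t i s | splitAt-↑ʳ t s k = refl

  Virus-pendant-clique : ∀ (k : Fin s) (i : Fin t) →
    Virus s t (t ↑ʳ k) (i ↑ˡ s) ≡ (toℕ i ≡ᵇ toℕ k)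
  Virus-pendant-clique k i rewrite splitAt-↑ˡ t i s | splitAt-↑ʳ t s k = refl

  Virus-pendant-pendant : ∀ (k l : Fin s) → Virus s t (t ↑ʳ k) (t ↑ʳ l) ≡ false
  Virus-pendant-pendant k l rewrite splitAt-↑ʳ t s k | splitAt-↑ʳ t s l = refl

  virus-clique-edge : ∀ {i j : Fin t} → i ≢ j → Edge (Virus s t) (i ↑ˡ s) (j ↑ˡ s)
  virus-clique-edge {i} {j} i≢j rewrite Virus-clique-clique i j =
    T-not⁺ (i≢j ∘ toℕ-injective ∘ ≡ᵇ⇒≡ (toℕ i) (toℕ j))

  virus-clique-edge⁻¹ : ∀ {i j : Fin t} → Edge (Virus s t) (i ↑ˡ s) (j ↑ˡ s) → i ≢ j
  virus-clique-edge⁻¹ {i} {j} e rewrite Virus-clique-clique i j =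
    T-not⁻ e ∘ ≡⇒≡ᵇ (toℕ i) (toℕ j) ∘ cong toℕ

  virus-attachment-edge⁻¹ : ∀ {i : Fin t} {k : Fin s} →
    Edge (Virus s t) (i ↑ˡ s) (t ↑ʳ k) → toℕ i ≡ toℕ k
  virus-attachment-edge⁻¹ {i} {k} e rewrite Virus-clique-pendant i k = ≡ᵇ⇒≡ (toℕ i) (toℕ k) e

  virus-attachment-edge⁻¹′ : ∀ {k : Fin s} {i : Fin t} →
    Edge (Virus s t) (t ↑ʳ k) (i ↑ˡ s) → toℕ i ≡ toℕ k
  virus-attachment-edge⁻¹′ {k} {i} e rewrite Virus-pendant-clique k i = ≡ᵇ⇒≡ (toℕ i) (toℕ k) e

  virus-no-pendant-edge : ∀ {k l : Fin s} → ¬ Edge (Virus s t) (t ↑ʳ k) (t ↑ʳ l)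
  virus-no-pendant-edge {k} {l} e rewrite Virus-pendant-pendant k l = e

module _ (t : ℕ) where
  open ≡-Reasoning

  private
    V : Graph (suc t + 1)
    V = Virus 1 (suc t)

    pendant : Fin (suc t + 1)
    pendant = suc t ↑ʳ zero

  virus₁-attachment-adjacent : ∀ y → y ≢ zero → Edge V zero y
  virus₁-attachment-adjacent y y≢0 with virusVertex (suc t) 1 y
  ... | clique-vertex j = virus-clique-edge 1 (suc t) (λ 0≡j → y≢0 (cong (_↑ˡ 1) (sym 0≡j)))
  ... | pendant-vertex zero rewrite Virus-clique-pendant 1 (suc t) zero zero = _

  virus₁-pendant-nonadjacent : ∀ y → y ≢ zero → ¬ Edge V pendant y
  virus₁-pendant-nonadjacent y y≢0 e with virusVertex (suc t) 1 y
  ... | clique-vertex j =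
    y≢0 (cong (_↑ˡ 1) (toℕ-injective (virus-attachment-edge⁻¹′ 1 (suc t) e)))
  ... | pendant-vertex zero = virus-no-pendant-edge 1 (suc t) e

  degree-virus₁-attachment : degree V zero ≡ t + 1
  degree-virus₁-attachment = begin
    length (filterᵇ (V zero) (zero ∷ tabulate suc))
      ≡⟨ cong length (filter-reject (T? ∘ V zero) {zero} {tabulate suc} (λ ())) ⟩
    length (filterᵇ (V zero) (tabulate suc))
      ≡⟨ cong length (filter-all (T? ∘ V zero) all-adjacent) ⟩
    length (tabulate {n = t + 1} suc)
      ≡⟨ length-tabulate suc ⟩
    t + 1 ∎
    where
    all-adjacent : All (T ∘ V zero) (tabulate suc)
    all-adjacent = tabulate⁺ λ y → virus₁-attachment-adjacent (suc y) (λ ())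

  degree-virus₁-pendant : degree V pendant ≡ 1
  degree-virus₁-pendant = begin
    length (filterᵇ (V pendant) (zero ∷ tabulate suc))
      ≡⟨ cong length (filter-accept (T? ∘ V pendant) {zero} {tabulate suc} adjacent) ⟩
    suc (length (filterᵇ (V pendant) (tabulate suc)))
      ≡⟨ cong (suc ∘ length) (filter-none (T? ∘ V pendant) none-adjacent) ⟩
    1 ∎
    where
    adjacent : Edge V pendant zero
    adjacent rewrite Virus-pendant-clique 1 (suc t) zero zero = _
    none-adjacent : All (¬_ ∘ T ∘ V pendant) (tabulate suc)
    none-adjacent = tabulate⁺ λ y → virus₁-pendant-nonadjacent (suc y) (λ ())

degree-virus₁≡⇒non-attachment : ∀ {t} → 2 ≤ t → (x : Fin (suc t + 1)) →
  degree (Virus 1 (suc t)) x ≡ t → ∃[ i ] i ≢ zero × i ↑ˡ 1 ≡ x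
degree-virus₁≡⇒non-attachment {t} 2≤t x d with virusVertex (suc t) 1 x
... | clique-vertex (suc i) = suc i , (λ ()) , refl
... | clique-vertex zero    = ⊥-elim (m+1+n≢m t (trans (sym (degree-virus₁-attachment t)) d))
... | pendant-vertex zero   = ⊥-elim (<⇒≢ 2≤t (trans (sym (degree-virus₁-pendant t)) d))

transpose-matchˡ : ∀ {m} (i j : Fin m) → PC.transpose i j i ≡ j
transpose-matchˡ i j rewrite dec-true (i ≟ i) refl = refl

transpose-fixed : ∀ {m} {i j k : Fin m} → k ≢ i → k ≢ j → PC.transpose i j k ≡ k
transpose-fixed {i = i} {j} {k} k≢i k≢j
  rewrite dec-false (k ≟ i) k≢i | dec-false (k ≟ j) k≢j = refl

two-point-permutation : ∀ {m} {a b : Fin (2 + m)} → a ≢ b →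
  ∃ λ (π : Permutation′ (2 + m)) → π ⟨$⟩ʳ zero ≡ a × π ⟨$⟩ʳ suc zero ≡ b
two-point-permutation {m} {a} {b} a≢b = transpose (suc zero) j ∘ₚ transpose zero a , π0≡a , π1≡b
  where
  open ≡-Reasoning
  j : Fin (2 + m)
  j = PC.transpose a zero b
  j≢0 : j ≢ zero
  j≢0 j≡0 = a≢b (begin
    a                        ≡⟨ transpose-matchˡ zero a ⟨
    PC.transpose zero a zero ≡⟨ cong (PC.transpose zero a) j≡0 ⟨
    PC.transpose zero a j    ≡⟨ PC.transpose-inverse zero a ⟩
    b                        ∎)
  π0≡a : PC.transpose zero a (PC.transpose (suc zero) j zero) ≡ a
  π0≡a = trans (cong (PC.transpose zero a) (transpose-fixed {i = suc zero} (λ ()) (j≢0 ∘ sym)))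
               (transpose-matchˡ zero a)
  π1≡b : PC.transpose zero a (PC.transpose (suc zero) j (suc zero)) ≡ b
  π1≡b = trans (cong (PC.transpose zero a) (transpose-matchˡ (suc zero) j)) (PC.transpose-inverse zero a)

module _ {n : ℕ} where

  infix 4 _∈Im_ _∉Im_ _∈Im?_

  _∈Im_ : ∀ {m} → Fin n → (Fin m → Fin n) → Set
  y ∈Im f = ∃[ i ] f i ≡ y

  _∉Im_ : ∀ {m} → Fin n → (Fin m → Fin n) → Set
  y ∉Im f = ¬ y ∈Im f

  _∈Im?_ : ∀ {m} (y : Fin n) (f : Fin m → Fin n) → Dec (y ∈Im f)
  y ∈Im? f = any? λ i → f i ≟ y

  ∈Im-∷⁺ : ∀ {m} {x y} {f : Fin m → Fin n} → y ∈Im f → y ∈Im (x ∷ᶠ f)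
  ∈Im-∷⁺ (i , fi≡y) = suc i , fi≡y

  ∈Im-∷⁻ : ∀ {m} {x y} {f : Fin m → Fin n} → y ∈Im (x ∷ᶠ f) → y ≢ x → y ∈Im f
  ∈Im-∷⁻ (zero  , x≡y)  y≢x = ⊥-elim (y≢x (sym x≡y))
  ∈Im-∷⁻ (suc i , fi≡y) _   = i , fi≡y

  ∷-injective : ∀ {m} {y} {f : Fin m → Fin n} →
    y ∉Im f → Injective _≡_ _≡_ f → Injective _≡_ _≡_ (y ∷ᶠ f)
  ∷-injective y∉f f-inj {zero}  {zero}  _ = refl
  ∷-injective y∉f f-inj {zero}  {suc j} e = ⊥-elim (y∉f (j , sym e))
  ∷-injective y∉f f-inj {suc i} {zero}  e = ⊥-elim (y∉f (i , e))
  ∷-injective y∉f f-inj {suc i} {suc j} e = cong suc (f-inj e)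

  ⊆Im⇒≤ : ∀ {k m} (f : Fin k → Fin n) {h : Fin m → Fin n} →
    Injective _≡_ _≡_ h → (∀ x → h x ∈Im f) → m ≤ k
  ⊆Im⇒≤ f h-inj h⊆f = injective⇒≤ {f = proj₁ ∘ h⊆f} λ {x} {y} e →
    h-inj (trans (sym (proj₂ (h⊆f x))) (trans (cong f e) (proj₂ (h⊆f y))))

  ∃∉Im : ∀ {k} (f : Fin k → Fin n) → k < n → ∃[ y ] y ∉Im f
  ∃∉Im f k<n with any? (λ y → ¬? (y ∈Im? f))
  ... | yes outside = outside
  ... | no none =
    ⊥-elim (<⇒≱ k<n (⊆Im⇒≤ f id λ y → decidable-stable (y ∈Im? f) (none ∘ (y ,_))))

  any-function? : ∀ m {P : (Fin m → Fin n) → Set} → (∀ {f g} → f ≗ g → P f → P g) →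
    (∀ f → Dec (P f)) → Dec (∃ P)
  any-function? zero resp P? =
    map′ (_ ,_) (λ (f , Pf) → resp (λ ()) Pf) (P? λ ())
  any-function? (suc m) resp P? =
    map′ (λ (a , g , P[a∷g]) → a ∷ᶠ g , P[a∷g])
         (λ (f , Pf) → head f , tail f , resp (λ { zero → refl ; (suc _) → refl }) Pf)
         (any? λ a → any-function? m (λ g≗g′ → resp λ { zero → refl ; (suc i) → g≗g′ i })
                                      (P? ∘ (a ∷ᶠ_)))

  injective? : ∀ {m} (f : Fin m → Fin n) → Dec (Injective _≡_ _≡_ f)
  injective? f = map′ (λ inj {i} {j} → inj i j) (λ inj i j → inj {i} {j})
    (all? λ i → all? λ j → (f i ≟ f j) →-dec (i ≟ j))

module _ {n : ℕ} (G : Graph n) where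

  Edge? : ∀ u v → Dec (Edge G u v)
  Edge? u v = T? (G u v)

  leaving-edge : (S : Fin n → Set) → (∀ z → Dec (S z)) →
    ∀ {u y} → S u → ¬ S y → Reach G u y → ∃[ s ] ∃[ r ] S s × ¬ S r × Edge G s r
  leaving-edge S S? Su ¬Sy here = ⊥-elim (¬Sy Su)
  leaving-edge S S? {u} Su ¬Sy (step {w = w} u~w w⇝y) with S? w
  ... | yes Sw = leaving-edge S S? Sw ¬Sy w⇝y
  ... | no ¬Sw = u , w , Su , ¬Sw , u~w

  edge-leaving-image : Connected G → ∀ {k} (f : Fin (suc k) → Fin n) → suc k < n →
    ∃[ a ] ∃[ x ] x ∉Im f × Edge G (f a) x
  edge-leaving-image connected f k<n with ∃∉Im f k<n
  ... | y , y∉f with leaving-edge (_∈Im f) (_∈Im? f) (zero , refl) y∉f (connected (f zero) y)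
  ... | _ , x , (a , refl) , x∉f , fa~x = a , x , x∉f , fa~x

  edge-leaving-head : Connected G → ∀ {k} {x} {f : Fin k → Fin n} → suc k < n →
    (∀ {c z} → Edge G (f c) z → z ∈Im (x ∷ᶠ f)) → ∃[ r ] r ∉Im (x ∷ᶠ f) × Edge G x r
  edge-leaving-head connected {x = x} {f} k<n closed
    with edge-leaving-image connected (x ∷ᶠ f) k<n
  ... | zero  , r , r∉ , x~r  = r , r∉ , x~r
  ... | suc c , r , r∉ , fc~r = ⊥-elim (r∉ (closed fc~r))

  record IsClique {m} (f : Fin m → Fin n) : Set where
    field
      injective : Injective _≡_ _≡_ f
      adjacent  : ∀ {i j} → i ≢ j → Edge G (f i) (f j)

  isClique? : ∀ {m} (f : Fin m → Fin n) → Dec (IsClique f)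
  isClique? f = map′
    (λ (inj , adj) → record { injective = λ {i} {j} → inj {i} {j} ; adjacent = λ {i} {j} → adj i j })
    (λ Q → (λ {i} {j} → IsClique.injective Q {i} {j}) , λ i j → IsClique.adjacent Q)
    (injective? f ×-dec all? λ i → all? λ j → ¬? (i ≟ j) →-dec Edge? (f i) (f j))

  IsClique-resp-≗ : ∀ {m} {f g : Fin m → Fin n} → f ≗ g → IsClique f → IsClique g
  IsClique-resp-≗ f≗g Q = record
    { injective = λ {i} {j} e → Q.injective (trans (f≗g i) (trans e (sym (f≗g j))))
    ; adjacent  = λ {i} {j} i≢j → subst₂ (Edge G) (f≗g i) (f≗g j) (Q.adjacent i≢j)
    }
    where module Q = IsClique Q

  IsClique-∘ : ∀ {m} {f : Fin m → Fin n} {σ : Fin m → Fin m} →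
    IsClique f → Injective _≡_ _≡_ σ → IsClique (f ∘ σ)
  IsClique-∘ Q σ-inj = record
    { injective = σ-inj ∘ Q.injective
    ; adjacent  = λ i≢j → Q.adjacent (i≢j ∘ σ-inj)
    }
    where module Q = IsClique Q

  clique⊆closedNeighbourhood : ∀ {m} {f : Fin m → Fin n} → IsClique f → (P : Fin n → Set) →
    ∀ {j} → P (f j) → (∀ {z} → Edge G (f j) z → P z) → ∀ i → P (f i)
  clique⊆closedNeighbourhood Q P {j} Pfj closed i with i ≟ j
  ... | yes refl = Pfj
  ... | no i≢j   = closed (IsClique.adjacent Q (i≢j ∘ sym))

  -- v has degree t − 1 in the copy of K¹ₜ formed by the clique and the pendant.
  record NonAttachmentVertex (t : ℕ) (v : Fin n) : Set where
    field
      clique           : Fin t → Fin n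
      isClique         : IsClique clique
      attachment       : Fin t
      pendant          : Fin n
      pendant∉clique   : pendant ∉Im clique
      attached         : Edge G (clique attachment) pendant
      index            : Fin t
      index≢attachment : index ≢ attachment
      clique-index     : clique index ≡ v

  degree≡⇒nonAttachmentVertex : ∀ {t} → 2 ≤ t → (H : Embedding (Virus 1 (suc t)) G) → ∀ x →
    degree (Virus 1 (suc t)) x ≡ t → NonAttachmentVertex (suc t) (Embedding.map H x)
  degree≡⇒nonAttachmentVertex {t} 2≤t H x d with degree-virus₁≡⇒non-attachment 2≤t x d
  ... | i , i≢0 , refl = record
    { clique           = map ∘ (_↑ˡ 1)
    ; isClique         = record
      { injective = ↑ˡ-injective 1 _ _ ∘ injective
      ; adjacent  = preserves _ _ ∘ virus-clique-edge 1 (suc t)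
      }
    ; attachment       = zero
    ; pendant          = map (suc t ↑ʳ zero)
    ; pendant∉clique   = λ (j , e) → ↑ˡ≢↑ʳ j zero (injective e)
    ; attached         = preserves _ _ (virus₁-attachment-adjacent t _ (↑ˡ≢↑ʳ zero zero ∘ sym))
    ; index            = i
    ; index≢attachment = i≢0
    ; clique-index     = refl
    }
    where open Embedding H

module _ {n : ℕ} (G : Graph n) (G-sym : ∀ u v → G u v ≡ G v u) where

  Edge-sym : ∀ {u v} → Edge G u v → Edge G v u
  Edge-sym {u} {v} = subst T (G-sym u v)

  module _ {m} {f : Fin (2 + m) → Fin n} (Q : IsClique G f) {p q : Fin n} (p≢q : p ≢ q)
           (p∉f : p ∉Im f) (q∉f : q ∉Im f)
           (f0~p : Edge G (f zero) p) (f1~q : Edge G (f (suc zero)) q) where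

    private
      module Q = IsClique Q

      pendants : Fin 2 → Fin n
      pendants = p ∷ᶠ q ∷ᶠ λ ()

      φ : Fin (2 + m + 2) → Fin n
      φ = [ f , pendants ]′ ∘ splitAt (2 + m)

      φ-clique : ∀ i → φ (i ↑ˡ 2) ≡ f i
      φ-clique i = cong [ f , pendants ]′ (splitAt-↑ˡ (2 + m) i 2)

      φ-pendant : ∀ k → φ (2 + m ↑ʳ k) ≡ pendants k
      φ-pendant k = cong [ f , pendants ]′ (splitAt-↑ʳ (2 + m) 2 k)

      f≢pendants : ∀ i k → f i ≢ pendants k
      f≢pendants i zero       e = p∉f (i , e)
      f≢pendants i (suc zero) e = q∉f (i , e)

      pendants-injective : Injective _≡_ _≡_ pendants
      pendants-injective =
        ∷-injective (λ { (zero , q≡p) → p≢q (sym q≡p) }) (λ { {zero} {zero} _ → refl })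

      attached : ∀ i k → toℕ i ≡ toℕ k → Edge G (f i) (pendants k)
      attached zero       zero       _ = f0~p
      attached (suc zero) (suc zero) _ = f1~q

      φ-injective : Injective _≡_ _≡_ φ
      φ-injective {x} {y} e with virusVertex (2 + m) 2 x | virusVertex (2 + m) 2 y
      ... | clique-vertex i  | clique-vertex j  =
        cong (_↑ˡ 2) (Q.injective (trans (sym (φ-clique i)) (trans e (φ-clique j))))
      ... | clique-vertex i  | pendant-vertex l =
        ⊥-elim (f≢pendants i l (trans (sym (φ-clique i)) (trans e (φ-pendant l))))
      ... | pendant-vertex k | clique-vertex j  =
        ⊥-elim (f≢pendants j k (trans (sym (φ-clique j)) (trans (sym e) (φ-pendant k))))
      ... | pendant-vertex k | pendant-vertex l =
        cong (2 + m ↑ʳ_) (pendants-injective (trans (sym (φ-pendant k)) (trans e (φ-pendant l))))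

      φ-preserves : ∀ x y → Edge (Virus 2 (2 + m)) x y → Edge G (φ x) (φ y)
      φ-preserves x y e with virusVertex (2 + m) 2 x | virusVertex (2 + m) 2 y
      ... | clique-vertex i  | clique-vertex j  =
        subst₂ (Edge G) (sym (φ-clique i)) (sym (φ-clique j))
          (Q.adjacent (virus-clique-edge⁻¹ 2 (2 + m) e))
      ... | clique-vertex i  | pendant-vertex l =
        subst₂ (Edge G) (sym (φ-clique i)) (sym (φ-pendant l))
          (attached i l (virus-attachment-edge⁻¹ 2 (2 + m) e))
      ... | pendant-vertex k | clique-vertex j  =
        subst₂ (Edge G) (sym (φ-pendant k)) (sym (φ-clique j))
          (Edge-sym (attached j k (virus-attachment-edge⁻¹′ 2 (2 + m) e)))
      ... | pendant-vertex k | pendant-vertex l = ⊥-elim (virus-no-pendant-edge 2 (2 + m) e)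

    virus₂ : Embedding (Virus 2 (2 + m)) G
    virus₂ = record { map = φ ; injective = φ-injective ; preserves = φ-preserves }

  virus₂-at : ∀ {m} {f : Fin (2 + m) → Fin n} → IsClique G f → ∀ {a b} → a ≢ b →
    ∀ {p q} → p ≢ q → p ∉Im f → q ∉Im f → Edge G (f a) p → Edge G (f b) q →
    Embedding (Virus 2 (2 + m)) G
  virus₂-at {m} {f} Q a≢b {p} {q} p≢q p∉f q∉f fa~p fb~q with two-point-permutation a≢b
  ... | π , π0≡a , π1≡b = virus₂ (IsClique-∘ G Q σ-injective) p≢q
          (λ (i , e) → p∉f (σ i , e)) (λ (i , e) → q∉f (σ i , e))
          (subst (λ c → Edge G (f c) p) (sym π0≡a) fa~p)
          (subst (λ c → Edge G (f c) q) (sym π1≡b) fb~q)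
    where
    σ : Fin (2 + m) → Fin (2 + m)
    σ = π ⟨$⟩ʳ_
    σ-injective : Injective _≡_ _≡_ σ
    σ-injective = Injection.injective (↔⇒↣ π)

  module K₂Free (k : ℕ) (K₂-free : ¬ Embedding (Virus 2 (3 + k)) G) where

    t : ℕ
    t = 3 + k

    private
      module N = NonAttachmentVertex

    no-two-pendants : ∀ {f : Fin t → Fin n} → IsClique G f → ∀ {a b} → a ≢ b →
      ∀ {p q} → p ≢ q → p ∉Im f → q ∉Im f → Edge G (f a) p → Edge G (f b) q → ⊥
    no-two-pendants Q a≢b p≢q p∉f q∉f fa~p fb~q =
      K₂-free (virus₂-at Q a≢b p≢q p∉f q∉f fa~p fb~q)

    shared-outside-neighbour : ∀ {f : Fin t → Fin n} → IsClique G f → ∀ {a b} → a ≢ b →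
      ∀ {p q} → p ∉Im f → q ∉Im f → Edge G (f a) p → Edge G (f b) q → p ≡ q
    shared-outside-neighbour Q a≢b {p} {q} p∉f q∉f fa~p fb~q =
      decidable-stable (p ≟ q) λ p≢q → no-two-pendants Q a≢b p≢q p∉f q∉f fa~p fb~q

    no-second-pendant : ∀ {v} (c : NonAttachmentVertex G t v) → let open N c in
      ∀ {w} → pendant ≢ w → w ∉Im clique → Edge G v w → ⊥
    no-second-pendant c p≢w w∉ v~w =
      no-two-pendants isClique (index≢attachment ∘ sym) p≢w pendant∉clique w∉ attached
        (subst (λ z → Edge G z _) (sym clique-index) v~w)
      where open N c

    no-two-outside-neighbours : ∀ {v} (c : NonAttachmentVertex G t v) → let open N c in
      ∀ {u u′} → u ≢ u′ → u ∉Im clique → u′ ∉Im clique →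
      Edge G v u → Edge G v u′ → ⊥
    no-two-outside-neighbours c {u} u≢u′ u∉ u′∉ v~u v~u′ with N.pendant c ≟ u
    ... | no p≢u   = no-second-pendant c p≢u u∉ v~u
    ... | yes refl = no-second-pendant c u≢u′ u′∉ v~u′

    sole-exit⇒¬nonAttachment : ∀ {f : Fin t → Fin n} → IsClique G f → ∀ a →
      (∀ {c z} → c ≢ a → Edge G (f c) z → z ∈Im f) → ¬ NonAttachmentVertex G t (f a)
    sole-exit⇒¬nonAttachment {f} Q a closed c
      with any? (λ j → any? λ m → (N.clique c j ≟ f m) ×-dec ¬? (m ≟ a))
    ... | yes (j , m , clique-j≡fm , m≢a) =
      1+n≰n (⊆Im⇒≤ f (∷-injective pendant∉clique C.injective) pendant∷clique⊆f)
      where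
      open N c
      module C = IsClique isClique
      clique⊆f : ∀ i → clique i ∈Im f
      clique⊆f = clique⊆closedNeighbourhood G isClique (_∈Im f) (m , sym clique-j≡fm)
                   (closed m≢a ∘ subst (λ z → Edge G z _) clique-j≡fm)
      m₀ : Fin t
      m₀ = proj₁ (clique⊆f attachment)
      fm₀≡attachment : f m₀ ≡ clique attachment
      fm₀≡attachment = proj₂ (clique⊆f attachment)
      m₀≢a : m₀ ≢ a
      m₀≢a m₀≡a = index≢attachment
        (C.injective (trans clique-index (trans (cong f (sym m₀≡a)) fm₀≡attachment)))
      pendant∷clique⊆f : ∀ x → (pendant ∷ᶠ clique) x ∈Im f
      pendant∷clique⊆f zero    =
        closed m₀≢a (subst (λ z → Edge G z pendant) (sym fm₀≡attachment) attached)
      pendant∷clique⊆f (suc i) = clique⊆f i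
    ... | no disjoint =
      no-two-outside-neighbours c (λ e → 0≢1 (punchIn-injective a _ _ (Q.injective e)))
        (outside zero) (outside (suc zero)) (fa~ zero) (fa~ (suc zero))
      where
      module Q = IsClique Q
      0≢1 : zero ≢ suc zero
      0≢1 ()
      outside : ∀ i → f (punchIn a i) ∉Im N.clique c
      outside i (j , e) = disjoint (j , punchIn a i , e , punchInᵢ≢i a i)
      fa~ : ∀ i → Edge G (f a) (f (punchIn a i))
      fa~ i = Q.adjacent (punchInᵢ≢i a i ∘ sym)

    common-outside-neighbour-is-sole : ∀ {f : Fin t → Fin n} → IsClique G f → ∀ {a b} → a ≢ b →
      ∀ {x} → x ∉Im f → Edge G (f a) x → Edge G (f b) x →
      ∀ {c z} → Edge G (f c) z → z ∈Im (x ∷ᶠ f)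
    common-outside-neighbour-is-sole {f} Q {a} {b} a≢b {x} x∉f fa~x fb~x {c} {z} fc~z
      with z ∈Im? f
    ... | yes z∈f = ∈Im-∷⁺ z∈f
    ... | no z∉f  = zero , sym z≡x
      where
      z≡x : z ≡ x
      z≡x with c ≟ a
      ... | yes refl = shared-outside-neighbour Q a≢b z∉f x∉f fc~z fb~x
      ... | no c≢a   = shared-outside-neighbour Q c≢a z∉f x∉f fc~z fa~x

    sole-outside-neighbour⇒¬nonAttachment : ∀ {f : Fin t → Fin n} → IsClique G f →
      ∀ {a b} → a ≢ b → ∀ {x} → Edge G x (f a) → Edge G x (f b) →
      (∀ {c z} → Edge G (f c) z → z ∈Im (x ∷ᶠ f)) →
      ∀ {r} → r ∉Im (x ∷ᶠ f) → Edge G x r → ¬ NonAttachmentVertex G t x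
    sole-outside-neighbour⇒¬nonAttachment {f} Q {a} {b} a≢b {x} x~fa x~fb closed {r} r∉ x~r c
      with any? (λ j → any? λ m → N.clique c j ≟ f m)
    ... | no disjoint =
      no-two-outside-neighbours c (a≢b ∘ IsClique.injective Q)
        (λ (j , e) → disjoint (j , a , e)) (λ (j , e) → disjoint (j , b , e)) x~fa x~fb
    ... | yes (j , m , clique-j≡fm) = no-second-pendant c pendant≢r r∉clique x~r
      where
      open N c
      module C = IsClique isClique
      clique⊆ : ∀ i → clique i ∈Im (x ∷ᶠ f)
      clique⊆ = clique⊆closedNeighbourhood G isClique (_∈Im (x ∷ᶠ f)) (suc m , sym clique-j≡fm)
                  (closed ∘ subst (λ z → Edge G z _) clique-j≡fm)
      attachment∈f : clique attachment ∈Im f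
      attachment∈f = ∈Im-∷⁻ (clique⊆ attachment)
                       (λ e → index≢attachment (C.injective (trans clique-index (sym e))))
      pendant∈f : pendant ∈Im f
      pendant∈f =
        ∈Im-∷⁻ (closed (subst (λ z → Edge G z pendant) (sym (proj₂ attachment∈f)) attached))
               (λ p≡x → pendant∉clique (index , trans clique-index (sym p≡x)))
      r∉clique : r ∉Im clique
      r∉clique (i , e) = r∉ (subst (_∈Im (x ∷ᶠ f)) e (clique⊆ i))
      pendant≢r : pendant ≢ r
      pendant≢r p≡r = r∉ (subst (_∈Im (x ∷ᶠ f)) p≡r (∈Im-∷⁺ pendant∈f))

    module _ (connected : Connected G) (1+t<n : suc t < n) where

      clique⇒∃¬nonAttachment : ∀ {f : Fin t → Fin n} → IsClique G f →
        ∃[ v ] ¬ NonAttachmentVertex G t v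
      clique⇒∃¬nonAttachment {f} Q with edge-leaving-image G connected f (<⇒≤ 1+t<n)
      ... | a , x , x∉f , fa~x
          with any? (λ b → any? λ z → ¬? (b ≟ a) ×-dec ¬? (z ∈Im? f) ×-dec Edge? G (f b) z)
      ... | no no-other-exit = f a , sole-exit⇒¬nonAttachment Q a closed
        where
        closed : ∀ {c z} → c ≢ a → Edge G (f c) z → z ∈Im f
        closed {c} {z} c≢a fc~z =
          decidable-stable (z ∈Im? f) λ z∉f → no-other-exit (c , z , c≢a , z∉f , fc~z)
      ... | yes (b , z , b≢a , z∉f , fb~z) =
        let (r , r∉ , x~r) = edge-leaving-head G connected 1+t<n closed
        in x , sole-outside-neighbour⇒¬nonAttachment Q (b≢a ∘ sym) (Edge-sym fa~x) (Edge-sym fb~x)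
                 closed r∉ x~r
        where
        fb~x : Edge G (f b) x
        fb~x = subst (Edge G (f b)) (shared-outside-neighbour Q b≢a z∉f x∉f fb~z fa~x) fb~z
        closed : ∀ {c z} → Edge G (f c) z → z ∈Im (x ∷ᶠ f)
        closed = common-outside-neighbour-is-sole Q (b≢a ∘ sym) x∉f fa~x fb~x

      ∃¬nonAttachment : ∃[ v ] ¬ NonAttachmentVertex G t v
      ∃¬nonAttachment with any-function? t (IsClique-resp-≗ G) (isClique? G)
      ... | yes (f , Q)  = clique⇒∃¬nonAttachment Q
      ... | no no-clique =
        fromℕ< (≤-trans (s≤s z≤n) 1+t<n) , λ c → no-clique (N.clique c , N.isClique c)

lemma2p2 : (t : ℕ) → 4 ≤ t → (n : ℕ) → (G : Graph n) → IsSimple G →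
    Connected G → Saturated t G →
    Σ (Fin n) λ v → (H : Embedding (Virus 1 t) G) → (x : Fin (t Data.Nat.+ 1)) →
      Embedding.map H x ≡ v → degree (Virus 1 t) x ≢ t ∸ 1
lemma2p2 .(4 + k) (s≤s (s≤s (s≤s (s≤s {n = k} _)))) n G (G-sym , _) connected (t+2≤n , K₂-free , _)
  with K₂Free.∃¬nonAttachment G G-sym (suc k) K₂-free connected
         (subst (_≤ n) (+-comm (4 + k) 2) t+2≤n)
... | v , ¬nonAttachment = v , λ H x Hx≡v degree≡t-1 → ¬nonAttachment
  (subst (NonAttachmentVertex G (4 + k)) Hx≡v
         (degree≡⇒nonAttachmentVertex G (s≤s (s≤s z≤n)) H x degree≡t-1))
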